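{- Let $p,q$ be complex numbers with $p^2-4q\neq0$, let $k$ be a positive integer with $U_k(p,q)\neq0$, and let $$F_k(x)=F_k(x;p,q)=\sum_{n\ge1}U_{nk}(p,q)x^{n-1}=\frac{U_k(p,q)}{1-V_k(p,q)x+q^kx^2}.$$ Then for every $d\ge1$, $$\sum_{j=0}^{d}(4q^k)^{d-j}\Big(\sum_{i=0}^{j}(-1)^i\binom{j}{i}(j+1-i)^d\Big)\Big(\frac{V_k^2(p,q)-4q^k}{U_k(p,q)}\Big)^{j}F_k(x)^{j+1}$$ $$=\sum_{j=1}^{d}\frac{(-1)^{d-1}(2q^k)^{d-j}}{(j-1)!}\Big(\sum_{i=0}^{j-1}(-1)^i\binom{j-1}{i}(i+1)^{d-1}\Big)\big(V_k(p,q)-2q^kx\big)^{j}F_k^{(j)}(x),$$ where $F_k^{(j)}$ denotes the $j$-th derivative of $F_k$ with respect to $x$.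
   Context: For complex $p,q$ with $p^2-4q\ne0$, put $\alpha=\frac12(p+\sqrt{p^2-4q})$, $\beta=\frac12(p-\sqrt{p^2-4q})$, and for $n\ge0$ define $U_n(p,q)=\frac{\alpha^n-\beta^n}{\alpha-\beta}$ and $V_n(p,q)=\alpha^n+\beta^n$ (generalized Fibonacci and Lucas numbers). The identity is an identity of rational functions / formal power series in $x$. -}

module Defs where

open import Level using (Level; _⊔_) renaming (suc to lsuc)
open import Algebra.Bundles using (CommutativeRing)
open import Data.Nat.Base using (ℕ; zero; suc; _∸_; _!) renaming (_+_ to _+ℕ_; _*_ to _*ℕ_; _^_ to _^ℕ_)
open import Data.Nat.Combinatorics.Base using (_C_)
open import Data.Product using (Σ; _,_)
open import Relation.Binary.PropositionalEquality using (_≡_; refl; subst)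
open import Relation.Nullary using (¬_)

module _ {c ℓ : Level} (R : CommutativeRing c ℓ) where
  open CommutativeRing R
  ι : ℕ → Carrier
  ι zero    = 0#
  ι (suc n) = 1# + ι n

record CharZeroField (c ℓ : Level) : Set (lsuc (c ⊔ ℓ)) where
  field
    cring : CommutativeRing c ℓ
  open CommutativeRing cring
  field
    inv      : (x : Carrier) → ¬ (x ≈ 0#) → Carrier
    inv-*    : (x : Carrier) (nz : ¬ (x ≈ 0#)) → x * inv x nz ≈ 1#
    charZero : (n : ℕ) → ¬ (ι cring (suc n) ≈ 0#)

fact-suc : (n : ℕ) → Σ ℕ (λ m → n ! ≡ suc m)
fact-suc zero = 0 , refl
fact-suc (suc n) with fact-suc n
... | m , eq = subst (λ t → Σ ℕ (λ m' → suc n *ℕ t ≡ suc m')) (Relation.Binary.PropositionalEquality.sym eq) (m +ℕ n *ℕ suc m , refl)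

module Theory {c ℓ : Level} (K : CharZeroField c ℓ) where
  open CharZeroField K public
  open CommutativeRing cring public

  _^_ : Carrier → ℕ → Carrier
  x ^ zero  = 1#
  x ^ suc n = x * (x ^ n)

  sumTo : ℕ → (ℕ → Carrier) → Carrier
  sumTo zero    f = f 0
  sumTo (suc n) f = sumTo n f + f (suc n)

  sgn : ℕ → Carrier
  sgn i = (- 1#) ^ i

  invFact : ℕ → Carrier
  invFact n with fact-suc n
  ... | m , eq = inv (ι cring (n !)) (subst (λ t → ¬ (ι cring t ≈ 0#)) (Relation.Binary.PropositionalEquality.sym eq) (charZero m))

  -- Formal power series in x: coefficient sequences ℕ → K.
  PS : Set c
  PS = ℕ → Carrier

  _≋_ : PS → PS → Set ℓ
  f ≋ g = (n : ℕ) → f n ≈ g n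

  _⊕_ : PS → PS → PS
  (f ⊕ g) n = f n + g n

  _⊙_ : Carrier → PS → PS
  (a ⊙ f) n = a * f n

  _⊛_ : PS → PS → PS
  (f ⊛ g) n = sumTo n (λ i → f i * g (n ∸ i))

  oneS : PS
  oneS zero    = 1#
  oneS (suc _) = 0#

  _^S_ : PS → ℕ → PS
  f ^S zero  = oneS
  f ^S suc n = f ⊛ (f ^S n)

  sumS : ℕ → (ℕ → PS) → PS
  sumS n f m = sumTo n (λ j → f j m)

  lin : Carrier → Carrier → PS
  lin a b zero          = a
  lin a b (suc zero)    = b
  lin a b (suc (suc _)) = 0#

  deriv : PS → PS
  deriv f n = ι cring (suc n) * f (suc n)

  derivN : ℕ → PS → PS
  derivN zero    f = f
  derivN (suc j) f = deriv (derivN j f)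

  -- Generalized Fibonacci / Lucas numbers via α, β (the two roots of
  -- t² - p t + q), so that p = α + β, q = α β, p² - 4q = (α - β)².
  module Lucas (α β : Carrier) (α≉β : ¬ (α - β ≈ 0#)) where
    p q : Carrier
    p = α + β
    q = α * β

    U V : ℕ → Carrier
    U n = ((α ^ n) - (β ^ n)) * inv (α - β) α≉β
    V n = (α ^ n) + (β ^ n)

    F : ℕ → PS
    F k n = U (suc n *ℕ k)

    A : ℕ → ℕ → Carrier
    A d j = sumTo j (λ i → sgn i * (ι cring (j C i) * ι cring ((suc j ∸ i) ^ℕ d)))

    B : ℕ → ℕ → Carrier
    B d j = sumTo (j ∸ 1) (λ i → sgn i * (ι cring ((j ∸ 1) C i) * ι cring (suc i ^ℕ (d ∸ 1))))

    LHS : (k d : ℕ) → ¬ (U k ≈ 0#) → PS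
    LHS k d hU = sumS d (λ j →
      (((ι cring 4 * (q ^ k)) ^ (d ∸ j)) * (A d j
        * ((((V k * V k) - (ι cring 4 * (q ^ k))) * inv (U k) hU) ^ j)))
      ⊙ (F k ^S suc j))

    -- right-hand side: Σ_{j=1}^{d}; the j = 0 term is set to 0
    RHS : (k d : ℕ) → PS
    RHS k d = sumS d (λ j → term j)
      where
      term : ℕ → PS
      term zero    _ = 0#
      term (suc j') =
        (sgn (d ∸ 1) * (((ι cring 2 * (q ^ k)) ^ (d ∸ suc j')) * (invFact j' * B d (suc j'))))
        ⊙ ((lin (V k) (- (ι cring 2 * (q ^ k))) ^S suc j') ⊛ derivN (suc j') (F k))

-- Both sides equal Θᵈ F for the operator Θ f = g · f′ with g = V_k − 2q^k x. Writing a = α^k and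
-- b = β^k, one has F = U_k / ((1 − ax)(1 − bx)) and g = a(1 − bx) + b(1 − ax), whence the Riccati
-- equation Θ F = r F² + 4q^k F with r = (V_k² − 4q^k)/U_k. So Θ acts bidiagonally on the powers
-- F^{j+1} and, since g′ = −2q^k, also on the products g^{j+1} F^{(j+1)}. In both expansions of Θᵈ F
-- the coefficients obey the recurrence A(d+1, j) = (j+1) A(d, j) + j A(d, j−1) of the alternating
-- sums A(d, j) = Σᵢ (−1)ⁱ C(j,i) (j+1−i)^d = j! S(d+1, j+1); the inner sums on the right are the same
-- sums read backwards, Σᵢ (−1)ⁱ C(j,i) (i+1)^d = (−1)^j A(d, j).

module Submission where

open import Defs
open import Level using (Level)
open import Algebra.Bundles using (CommutativeRing)
open import Algebra.Solver.Ring.AlmostCommutativeRing using (fromCommutativeRing; _-Raw-AlmostCommutative⟶_)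
open import Data.Integer.Base as ℤ using (ℤ; +_; -[1+_]; +[1+_]; _⊖_; sign; ∣_∣; _◃_)
import Data.Integer.Properties as ℤ
open import Data.Maybe.Base using (Maybe; just; nothing)
open import Data.Nat.Base as ℕ using (ℕ; zero; suc; _≤_; _<_; _∸_; z≤n; s≤s; _!)
import Data.Nat.Properties as ℕ
open import Data.Nat.Combinatorics using (nCk+nC[k+1]≡[n+1]C[k+1]; nCk≡nC[n∸k]; nC1≡n)
open import Data.Nat.Combinatorics.Base using (_C_)
open import Data.Nat.Combinatorics.Specification using (k>n⇒nCk≡0)
open import Data.Nat.Tactic.RingSolver using (solve-∀)
open import Data.Product.Base using (_,_)
open import Data.Sign.Base as Sign using (Sign)
open import Data.Sum.Base using (inj₁; inj₂)
open import Relation.Nullary using (¬_)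
open import Relation.Nullary.Decidable using (yes; no)
import Relation.Binary.PropositionalEquality as ≡
open ≡ using (_≡_)

C-absorption : ∀ n k → suc k ℕ.* (suc n C suc k) ≡ suc n ℕ.* (n C k)
C-absorption zero    zero    = ≡.refl
C-absorption zero    (suc k) = ℕ.*-zeroʳ (suc (suc k))
C-absorption (suc n) zero    = ≡.trans (ℕ.+-identityʳ _) (≡.trans (nC1≡n (suc (suc n))) (≡.sym (ℕ.*-identityʳ _)))
C-absorption (suc n) (suc k) = begin
  suc (suc k) ℕ.* (suc (suc n) C suc (suc k))
    ≡⟨ ≡.cong (suc (suc k) ℕ.*_) (nCk+nC[k+1]≡[n+1]C[k+1] (suc n) (suc k)) ⟨
  suc (suc k) ℕ.* (suc n C suc k ℕ.+ suc n C suc (suc k))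
    ≡⟨ rearrange₁ k (suc n C suc k) (suc n C suc (suc k)) ⟩
  suc k ℕ.* (suc n C suc k) ℕ.+ suc n C suc k ℕ.+ suc (suc k) ℕ.* (suc n C suc (suc k))
    ≡⟨ ≡.cong₂ (λ x y → x ℕ.+ suc n C suc k ℕ.+ y) (C-absorption n k) (C-absorption n (suc k)) ⟩
  suc n ℕ.* (n C k) ℕ.+ suc n C suc k ℕ.+ suc n ℕ.* (n C suc k)
    ≡⟨ rearrange₂ n (n C k) (n C suc k) (suc n C suc k) ⟩
  suc n ℕ.* (n C k ℕ.+ n C suc k) ℕ.+ suc n C suc k
    ≡⟨ ≡.cong (λ x → suc n ℕ.* x ℕ.+ suc n C suc k) (nCk+nC[k+1]≡[n+1]C[k+1] n k) ⟩
  suc n ℕ.* (suc n C suc k) ℕ.+ suc n C suc k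
    ≡⟨ rearrange₃ n (suc n C suc k) ⟩
  suc (suc n) ℕ.* (suc n C suc k) ∎
  where
  open ≡.≡-Reasoning
  rearrange₁ : ∀ k x y → suc (suc k) ℕ.* (x ℕ.+ y) ≡ suc k ℕ.* x ℕ.+ x ℕ.+ suc (suc k) ℕ.* y
  rearrange₁ = solve-∀
  rearrange₂ : ∀ n x y z → suc n ℕ.* x ℕ.+ z ℕ.+ suc n ℕ.* y ≡ suc n ℕ.* (x ℕ.+ y) ℕ.+ z
  rearrange₂ = solve-∀
  rearrange₃ : ∀ n x → suc n ℕ.* x ℕ.+ x ≡ suc (suc n) ℕ.* x
  rearrange₃ = solve-∀

module ℤ-CoefficientSolver {c ℓ : Level} (R : CommutativeRing c ℓ) where
  open CommutativeRing R
  open import Algebra.Properties.Ring ring using (-‿involutive; -0#≈0#; -1*x≈-x; -‿+-comm)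
  open import Algebra.Properties.Semiring.Mult semiring using (_×_; ×-homo-+; ×1-homo-*)
  open import Algebra.Properties.CommutativeSemigroup +-commutativeSemigroup
    using () renaming (interchange to +-interchange)
  open import Algebra.Properties.CommutativeSemigroup *-commutativeSemigroup
    using () renaming (interchange to *-interchange)
  open import Relation.Binary.Reasoning.Setoid setoid

  fromℤ : ℤ → Carrier
  fromℤ (+ n)    = n × 1#
  fromℤ -[1+ n ] = - (suc n × 1#)

  fromℤ-neg : ∀ i → fromℤ (ℤ.- i) ≈ - fromℤ i
  fromℤ-neg -[1+ n ] = sym (-‿involutive _)
  fromℤ-neg (+ zero) = sym -0#≈0#
  fromℤ-neg +[1+ n ] = refl

  fromℤ-⊖ : ∀ m n → fromℤ (m ⊖ n) ≈ m × 1# - n × 1#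
  fromℤ-⊖ m       zero    = sym (trans (+-congˡ -0#≈0#) (+-identityʳ _))
  fromℤ-⊖ zero    (suc n) = sym (+-identityˡ _)
  fromℤ-⊖ (suc m) (suc n) = begin
    fromℤ (suc m ⊖ suc n)           ≡⟨ ≡.cong fromℤ (ℤ.[1+m]⊖[1+n]≡m⊖n m n) ⟩
    fromℤ (m ⊖ n)                   ≈⟨ fromℤ-⊖ m n ⟩
    m × 1# - n × 1#                 ≈⟨ +-identityˡ _ ⟨
    0# + (m × 1# - n × 1#)          ≈⟨ +-congʳ (-‿inverseʳ 1#) ⟨
    (1# - 1#) + (m × 1# - n × 1#)   ≈⟨ +-interchange _ _ _ _ ⟩
    suc m × 1# + (- 1# - n × 1#)    ≈⟨ +-congˡ (-‿+-comm _ _) ⟩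
    suc m × 1# - suc n × 1#         ∎

  fromℤ-+ : ∀ i j → fromℤ (i ℤ.+ j) ≈ fromℤ i + fromℤ j
  fromℤ-+ -[1+ m ] -[1+ n ] = begin
    - (suc (suc (m ℕ.+ n)) × 1#)       ≡⟨ ≡.cong (λ k → - (suc k × 1#)) (ℕ.+-suc m n) ⟨
    - ((suc m ℕ.+ suc n) × 1#)         ≈⟨ -‿cong (×-homo-+ 1# (suc m) (suc n)) ⟩
    - (suc m × 1# + suc n × 1#)        ≈⟨ -‿+-comm _ _ ⟨
    - (suc m × 1#) + - (suc n × 1#)    ∎
  fromℤ-+ -[1+ m ] (+ n)    = trans (fromℤ-⊖ n (suc m)) (+-comm _ _)
  fromℤ-+ (+ m)    -[1+ n ] = fromℤ-⊖ m (suc n)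
  fromℤ-+ (+ m)    (+ n)    = ×-homo-+ 1# m n

  fromSign : Sign → Carrier
  fromSign Sign.+ = 1#
  fromSign Sign.- = - 1#

  fromSign-* : ∀ s t → fromSign (s Sign.* t) ≈ fromSign s * fromSign t
  fromSign-* Sign.- Sign.- = trans (sym (-‿involutive _)) (sym (-1*x≈-x _))
  fromSign-* Sign.- Sign.+ = sym (*-identityʳ _)
  fromSign-* Sign.+ t      = sym (*-identityˡ _)

  fromℤ-◃ : ∀ s n → fromℤ (s ◃ n) ≈ fromSign s * (n × 1#)
  fromℤ-◃ s      zero    = sym (zeroʳ _)
  fromℤ-◃ Sign.+ (suc n) = sym (*-identityˡ _)
  fromℤ-◃ Sign.- (suc n) = sym (-1*x≈-x _)

  fromℤ-* : ∀ i j → fromℤ (i ℤ.* j) ≈ fromℤ i * fromℤ j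
  fromℤ-* i j = begin
    fromℤ ((sign i Sign.* sign j) ◃ (∣ i ∣ ℕ.* ∣ j ∣))
      ≈⟨ fromℤ-◃ (sign i Sign.* sign j) (∣ i ∣ ℕ.* ∣ j ∣) ⟩
    fromSign (sign i Sign.* sign j) * ((∣ i ∣ ℕ.* ∣ j ∣) × 1#)
      ≈⟨ *-cong (fromSign-* (sign i) (sign j)) (×1-homo-* ∣ i ∣ ∣ j ∣) ⟩
    (fromSign (sign i) * fromSign (sign j)) * (∣ i ∣ × 1# * ∣ j ∣ × 1#)
      ≈⟨ *-interchange _ _ _ _ ⟩
    (fromSign (sign i) * ∣ i ∣ × 1#) * (fromSign (sign j) * ∣ j ∣ × 1#)
      ≈⟨ *-cong (fromℤ-sign◃abs i) (fromℤ-sign◃abs j) ⟨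
    fromℤ i * fromℤ j ∎
    where
    fromℤ-sign◃abs : ∀ i → fromℤ i ≈ fromSign (sign i) * (∣ i ∣ × 1#)
    fromℤ-sign◃abs i = trans (reflexive (≡.cong fromℤ (≡.sym (ℤ.◃-inverse i)))) (fromℤ-◃ (sign i) ∣ i ∣)

  ℤ⟶R : ℤ.+-*-rawRing -Raw-AlmostCommutative⟶ fromCommutativeRing R
  ℤ⟶R = record
    { ⟦_⟧    = fromℤ
    ; +-homo = fromℤ-+
    ; *-homo = fromℤ-*
    ; -‿homo = fromℤ-neg
    ; 0-homo = refl
    ; 1-homo = +-identityʳ 1#
    }

  ℤ-dec : ∀ i j → Maybe (fromℤ i ≈ fromℤ j)
  ℤ-dec i j with i ℤ.≟ j
  ... | yes i≡j = just (reflexive (≡.cong fromℤ i≡j))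
  ... | no _    = nothing

  -- `con (+ n)` denotes `n × 1#`, which is `ι R n`; in particular `con (+ 1)` is `1# + 0#`, not `1#`.
  open import Algebra.Solver.Ring ℤ.+-*-rawRing (fromCommutativeRing R) ℤ⟶R ℤ-dec public


module _ {c ℓ : Level} (R : CommutativeRing c ℓ) where
  open CommutativeRing R
  open ℤ-CoefficientSolver R
  open import Relation.Binary.Reasoning.Setoid setoid

  add-fractions : ∀ {La Ga Lb Gb} → La * Ga ≈ 1# → Lb * Gb ≈ 1# →
    ∀ x y → (x * Lb + y * La) * (Ga * Gb) ≈ x * Ga + y * Gb
  add-fractions {La} {Ga} {Lb} {Gb} LaGa≈1 LbGb≈1 x y = begin
    (x * Lb + y * La) * (Ga * Gb)
      ≈⟨ solve 6 (λ x y La Ga Lb Gb → (x :* Lb :+ y :* La) :* (Ga :* Gb) := x :* Ga :* (Lb :* Gb) :+ y :* Gb :* (La :* Ga))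
           refl x y La Ga Lb Gb ⟩
    x * Ga * (Lb * Gb) + y * Gb * (La * Ga) ≈⟨ +-cong (*-congˡ LbGb≈1) (*-congˡ LaGa≈1) ⟩
    x * Ga * 1# + y * Gb * 1#             ≈⟨ +-cong (*-identityʳ _) (*-identityʳ _) ⟩
    x * Ga + y * Gb                       ∎


module _ {c ℓ : Level} (K : CharZeroField c ℓ) where
  open Theory K

  module FieldArithmetic where
    open ℤ-CoefficientSolver cring
    open import Algebra.Properties.Ring ring using (-1*x≈-x)
    open import Algebra.Properties.Semiring.Mult semiring using (_×_; ×-homo-+; ×1-homo-*)
    open import Relation.Binary.Reasoning.Setoid setoid

    ιK : ℕ → Carrier
    ιK = ι cring

    ι≈× : ∀ n → ιK n ≈ n × 1#
    ι≈× zero    = refl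
    ι≈× (suc n) = +-congˡ (ι≈× n)

    ι-cong : ∀ {m n} → m ≡.≡ n → ιK m ≈ ιK n
    ι-cong m≡n = reflexive (≡.cong ιK m≡n)

    ι-+ : ∀ m n → ιK (m ℕ.+ n) ≈ ιK m + ιK n
    ι-+ m n = trans (ι≈× (m ℕ.+ n)) (trans (×-homo-+ 1# m n) (sym (+-cong (ι≈× m) (ι≈× n))))

    ι-* : ∀ m n → ιK (m ℕ.* n) ≈ ιK m * ιK n
    ι-* m n = trans (ι≈× (m ℕ.* n)) (trans (×1-homo-* m n) (sym (*-cong (ι≈× m) (ι≈× n))))

    ι-∸ : ∀ {m n} → n ≤ m → ιK (m ∸ n) ≈ ιK m - ιK n
    ι-∸ {m} {n} n≤m = begin
      ιK (m ∸ n)                  ≈⟨ solve 2 (λ x y → x := (y :+ x) :- y) refl (ιK (m ∸ n)) (ιK n) ⟩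
      ιK n + ιK (m ∸ n) - ιK n    ≈⟨ +-congʳ (ι-+ n (m ∸ n)) ⟨
      ιK (n ℕ.+ (m ∸ n)) - ιK n   ≈⟨ +-congʳ (ι-cong (ℕ.m+[n∸m]≡n n≤m)) ⟩
      ιK m - ιK n                 ∎

    ^-+ : ∀ x m n → x ^ (m ℕ.+ n) ≈ x ^ m * x ^ n
    ^-+ x zero    n = sym (*-identityˡ _)
    ^-+ x (suc m) n = trans (*-congˡ (^-+ x m n)) (sym (*-assoc _ _ _))

    ^-* : ∀ x m n → x ^ (m ℕ.* n) ≈ (x ^ n) ^ m
    ^-* x zero    n = refl
    ^-* x (suc m) n = trans (^-+ x n (m ℕ.* n)) (*-congˡ (^-* x m n))

    *-^ : ∀ x y n → (x * y) ^ n ≈ x ^ n * y ^ n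
    *-^ x y zero    = sym (*-identityˡ 1#)
    *-^ x y (suc n) = trans (*-congˡ (*-^ x y n)) (solve 4 (λ x y u v → x :* y :* (u :* v) := x :* u :* (y :* v)) refl x y (x ^ n) (y ^ n))

    sgn-suc : ∀ i → sgn (suc i) ≈ - sgn i
    sgn-suc i = -1*x≈-x (sgn i)

    sgn-square : ∀ i → sgn i * sgn i ≈ 1#
    sgn-square zero    = *-identityˡ 1#
    sgn-square (suc i) = begin
      sgn (suc i) * sgn (suc i)   ≈⟨ *-cong (sgn-suc i) (sgn-suc i) ⟩
      - sgn i * - sgn i           ≈⟨ solve 1 (λ s → :- s :* :- s := s :* s) refl (sgn i) ⟩
      sgn i * sgn i               ≈⟨ sgn-square i ⟩
      1#                          ∎

    invFact-inverse : ∀ n → invFact n * ιK (n !) ≈ 1#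
    invFact-inverse n with fact-suc n
    ... | _ , _ = trans (*-comm _ _) (inv-* _ _)

    invFact-0 : invFact 0 ≈ 1#
    invFact-0 = trans (sym (*-identityʳ _)) (trans (*-congˡ (sym (+-identityʳ 1#))) (invFact-inverse 0))

    invFact-suc : ∀ n → invFact n ≈ ιK (suc n) * invFact (suc n)
    invFact-suc n = begin
      invFact n                                           ≈⟨ *-identityʳ _ ⟨
      invFact n * 1#                                      ≈⟨ *-congˡ (invFact-inverse (suc n)) ⟨
      invFact n * (invFact (suc n) * ιK (suc n ℕ.* n !))  ≈⟨ *-congˡ (*-congˡ (ι-* (suc n) (n !))) ⟩
      invFact n * (invFact (suc n) * (ιK (suc n) * ιK (n !)))
        ≈⟨ solve 4 (λ y x s f → y :* (x :* (s :* f)) := (s :* x) :* (y :* f)) refl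
             (invFact n) (invFact (suc n)) (ιK (suc n)) (ιK (n !)) ⟩
      ιK (suc n) * invFact (suc n) * (invFact n * ιK (n !)) ≈⟨ *-congˡ (invFact-inverse n) ⟩
      ιK (suc n) * invFact (suc n) * 1#                     ≈⟨ *-identityʳ _ ⟩
      ιK (suc n) * invFact (suc n)                          ∎

  module FiniteSums where
    open FieldArithmetic
    open ℤ-CoefficientSolver cring
    open import Algebra.Properties.Ring ring using (-1*x≈-x)

    sumTo-cong : ∀ n {f g : ℕ → Carrier} → (∀ i → i ≤ n → f i ≈ g i) → sumTo n f ≈ sumTo n g
    sumTo-cong zero    f≈g = f≈g 0 z≤n
    sumTo-cong (suc n) f≈g = +-cong (sumTo-cong n (λ i i≤n → f≈g i (ℕ.m≤n⇒m≤1+n i≤n))) (f≈g (suc n) ℕ.≤-refl)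

    sumTo-+ : ∀ n (f g : ℕ → Carrier) → sumTo n (λ i → f i + g i) ≈ sumTo n f + sumTo n g
    sumTo-+ zero    f g = refl
    sumTo-+ (suc n) f g = trans (+-congʳ (sumTo-+ n f g))
      (solve 4 (λ a b x y → a :+ b :+ (x :+ y) := a :+ x :+ (b :+ y)) refl _ _ _ _)

    sumTo-*ˡ : ∀ n a (f : ℕ → Carrier) → a * sumTo n f ≈ sumTo n (λ i → a * f i)
    sumTo-*ˡ zero    a f = refl
    sumTo-*ˡ (suc n) a f = trans (distribˡ _ _ _) (+-congʳ (sumTo-*ˡ n a f))

    sumTo-neg : ∀ n (f : ℕ → Carrier) → - sumTo n f ≈ sumTo n (λ i → - f i)
    sumTo-neg n f = trans (sym (-1*x≈-x _)) (trans (sumTo-*ˡ n (- 1#) f) (sumTo-cong n (λ i _ → -1*x≈-x _)))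

    sumTo-- : ∀ n (f g : ℕ → Carrier) → sumTo n (λ i → f i - g i) ≈ sumTo n f - sumTo n g
    sumTo-- n f g = trans (sumTo-+ n f (λ i → - g i)) (+-congˡ (sym (sumTo-neg n g)))

    sumTo-suc : ∀ n (f : ℕ → Carrier) → sumTo (suc n) f ≈ f 0 + sumTo n (λ i → f (suc i))
    sumTo-suc zero    f = refl
    sumTo-suc (suc n) f = trans (+-congʳ (sumTo-suc n f)) (+-assoc _ _ _)

    sumTo-zero : ∀ n {f : ℕ → Carrier} → (∀ i → i ≤ n → f i ≈ 0#) → sumTo n f ≈ 0#
    sumTo-zero zero    f≈0 = f≈0 0 z≤n
    sumTo-zero (suc n) f≈0 =
      trans (+-cong (sumTo-zero n (λ i i≤n → f≈0 i (ℕ.m≤n⇒m≤1+n i≤n))) (f≈0 (suc n) ℕ.≤-refl)) (+-identityʳ 0#)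

    sumTo-reverse : ∀ n (f : ℕ → Carrier) → sumTo n f ≈ sumTo n (λ i → f (n ∸ i))
    sumTo-reverse zero    f = refl
    sumTo-reverse (suc n) f = trans (+-congʳ (sumTo-reverse n f)) (trans (+-comm _ _) (sym (sumTo-suc n _)))

    sumTo-telescope : ∀ n (u : ℕ → Carrier) → sumTo n (λ i → u (suc i) - u i) ≈ u (suc n) - u 0
    sumTo-telescope zero    u = refl
    sumTo-telescope (suc n) u = trans (+-congʳ (sumTo-telescope n u))
      (solve 3 (λ a b c → b :- a :+ (c :- b) := c :- a) refl (u 0) (u (suc n)) (u (suc (suc n))))

    sumTo-const : ∀ n x → sumTo n (λ _ → x) ≈ ιK (suc n) * x
    sumTo-const zero    x = solve 1 (λ x → x := con (+ 1) :* x) refl x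
    sumTo-const (suc n) x = trans (+-congʳ (sumTo-const n x))
      (sym (trans (distribʳ x 1# (ιK (suc n))) (trans (+-congʳ (*-identityˡ x)) (+-comm _ _))))


  module StirlingCoefficients where
    open FieldArithmetic
    open FiniteSums
    open ℤ-CoefficientSolver cring
    open import Relation.Binary.Reasoning.Setoid setoid

    alternating-binomial : ∀ t → sumTo (suc t) (λ i → sgn i * ιK (suc t C i)) ≈ 0#
    alternating-binomial t = begin
      sumTo (suc t) (λ i → sgn i * ιK (suc t C i))
        ≈⟨ sumTo-suc t _ ⟩
      1# * ιK 1 + sumTo t (λ i → sgn (suc i) * ιK (suc t C suc i))
        ≈⟨ +-congˡ (sumTo-cong t (λ i _ → pascal i)) ⟩
      1# * ιK 1 + sumTo t (λ i → u (suc i) - u i)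
        ≈⟨ +-congˡ (sumTo-telescope t u) ⟩
      1# * ιK 1 + (sgn (suc t) * ιK (t C suc t) - 1# * ιK 1)
        ≈⟨ +-congˡ (+-congʳ (*-congˡ (ι-cong (k>n⇒nCk≡0 (ℕ.n<1+n t))))) ⟩
      1# * ιK 1 + (sgn (suc t) * 0# - 1# * ιK 1)
        ≈⟨ solve 2 (λ o s → o :+ (s :* con (+ 0) :- o) := con (+ 0)) refl (1# * ιK 1) (sgn (suc t)) ⟩
      0# ∎
      where
      u : ℕ → Carrier
      u i = sgn i * ιK (t C i)
      pascal : ∀ i → sgn (suc i) * ιK (suc t C suc i) ≈ u (suc i) - u i
      pascal i = begin
        sgn (suc i) * ιK (suc t C suc i)           ≈⟨ *-cong (sgn-suc i) (ι-cong (≡.sym (nCk+nC[k+1]≡[n+1]C[k+1] t i))) ⟩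
        - sgn i * ιK (t C i ℕ.+ t C suc i)         ≈⟨ *-congˡ (ι-+ (t C i) (t C suc i)) ⟩
        - sgn i * (ιK (t C i) + ιK (t C suc i))
          ≈⟨ solve 3 (λ s x y → :- s :* (x :+ y) := :- s :* y :- s :* x) refl (sgn i) (ιK (t C i)) (ιK (t C suc i)) ⟩
        - sgn i * ιK (t C suc i) - u i             ≈⟨ +-congʳ (*-congʳ (sgn-suc i)) ⟨
        u (suc i) - u i                            ∎

    -- The sum `Lucas.A d j`, stated without the parameters α, β that it does not use.
    stirlingA : ℕ → ℕ → Carrier
    stirlingA d j = sumTo j (λ i → sgn i * (ιK (j C i) * ιK ((suc j ∸ i) ℕ.^ d)))

    stirlingA-0 : ∀ d → stirlingA d 0 ≈ 1#
    stirlingA-0 d = trans (*-congˡ (*-congˡ (ι-cong (ℕ.^-zeroˡ d))))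
      (solve 1 (λ o → o :* (con (+ 1) :* con (+ 1)) := o) refl 1#)

    stirlingA-suc : ∀ d t →
      stirlingA (suc d) (suc t) ≈ ιK (suc (suc t)) * stirlingA d (suc t) + ιK (suc t) * stirlingA d t
    stirlingA-suc d t = begin
      stirlingA (suc d) (suc t)                               ≈⟨ sumTo-cong (suc t) split ⟩
      sumTo (suc t) (λ i → ιK (suc (suc t)) * w i - ιK i * w i) ≈⟨ sumTo-- (suc t) _ _ ⟩
      sumTo (suc t) (λ i → ιK (suc (suc t)) * w i) - sumTo (suc t) (λ i → ιK i * w i)
        ≈⟨ +-cong (sym (sumTo-*ˡ (suc t) _ w)) (-‿cong absorbed) ⟩
      ιK (suc (suc t)) * stirlingA d (suc t) - - (ιK (suc t) * stirlingA d t)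
        ≈⟨ solve 2 (λ x y → x :- :- y := x :+ y) refl _ _ ⟩
      ιK (suc (suc t)) * stirlingA d (suc t) + ιK (suc t) * stirlingA d t ∎
      where
      w : ℕ → Carrier
      w i = sgn i * (ιK (suc t C i) * ιK ((suc (suc t) ∸ i) ℕ.^ d))
      split : ∀ i → i ≤ suc t →
        sgn i * (ιK (suc t C i) * ιK ((suc (suc t) ∸ i) ℕ.^ suc d)) ≈ ιK (suc (suc t)) * w i - ιK i * w i
      split i i≤1+t = begin
        sgn i * (ιK (suc t C i) * ιK ((suc (suc t) ∸ i) ℕ.* (suc (suc t) ∸ i) ℕ.^ d))
          ≈⟨ *-congˡ (*-congˡ (trans (ι-* (suc (suc t) ∸ i) ((suc (suc t) ∸ i) ℕ.^ d)) (*-congʳ (ι-∸ (ℕ.m≤n⇒m≤1+n i≤1+t))))) ⟩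
        sgn i * (ιK (suc t C i) * ((ιK (suc (suc t)) - ιK i) * ιK ((suc (suc t) ∸ i) ℕ.^ d)))
          ≈⟨ solve 5 (λ s c x y p → s :* (c :* ((x :- y) :* p)) := x :* (s :* (c :* p)) :- y :* (s :* (c :* p))) refl
               (sgn i) (ιK (suc t C i)) (ιK (suc (suc t))) (ιK i) (ιK ((suc (suc t) ∸ i) ℕ.^ d)) ⟩
        ιK (suc (suc t)) * w i - ιK i * w i ∎
      absorbed : sumTo (suc t) (λ i → ιK i * w i) ≈ - (ιK (suc t) * stirlingA d t)
      absorbed = begin
        sumTo (suc t) (λ i → ιK i * w i)                ≈⟨ sumTo-suc t _ ⟩
        0# * w 0 + sumTo t (λ i → ιK (suc i) * w (suc i)) ≈⟨ +-cong (zeroˡ _) (sumTo-cong t (λ i _ → absorb i)) ⟩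
        0# + sumTo t (λ i → - (ιK (suc t) * (sgn i * (ιK (t C i) * ιK ((suc t ∸ i) ℕ.^ d)))))
          ≈⟨ trans (+-identityˡ _) (sym (sumTo-neg t _)) ⟩
        - sumTo t (λ i → ιK (suc t) * (sgn i * (ιK (t C i) * ιK ((suc t ∸ i) ℕ.^ d))))
          ≈⟨ -‿cong (sumTo-*ˡ t _ _) ⟨
        - (ιK (suc t) * stirlingA d t)                  ∎
        where
        absorb : ∀ i → ιK (suc i) * w (suc i) ≈ - (ιK (suc t) * (sgn i * (ιK (t C i) * ιK ((suc t ∸ i) ℕ.^ d))))
        absorb i = begin
          ιK (suc i) * (sgn (suc i) * (ιK (suc t C suc i) * p))
            ≈⟨ solve 4 (λ a s b p → a :* (s :* (b :* p)) := s :* ((a :* b) :* p)) refl _ _ _ p ⟩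
          sgn (suc i) * ((ιK (suc i) * ιK (suc t C suc i)) * p)   ≈⟨ *-cong (sgn-suc i) (*-congʳ absorption) ⟩
          - sgn i * ((ιK (suc t) * ιK (t C i)) * p)
            ≈⟨ solve 4 (λ s a b p → :- s :* ((a :* b) :* p) := :- (a :* (s :* (b :* p)))) refl _ _ _ p ⟩
          - (ιK (suc t) * (sgn i * (ιK (t C i) * p)))            ∎
          where
          p = ιK ((suc t ∸ i) ℕ.^ d)
          absorption : ιK (suc i) * ιK (suc t C suc i) ≈ ιK (suc t) * ιK (t C i)
          absorption = trans (sym (ι-* (suc i) (suc t C suc i))) (trans (ι-cong (C-absorption t i)) (ι-* (suc t) (t C i)))

    stirlingA-vanish : ∀ {d j} → d < j → stirlingA d j ≈ 0#
    stirlingA-vanish {zero}  {suc t} _ = trans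
      (sumTo-cong (suc t) (λ i _ → *-congˡ (solve 1 (λ x → x :* con (+ 1) := x) refl (ιK (suc t C i)))))
      (alternating-binomial t)
    stirlingA-vanish {suc d} {suc t} (s≤s d<t) = begin
      stirlingA (suc d) (suc t)                                         ≈⟨ stirlingA-suc d t ⟩
      ιK (suc (suc t)) * stirlingA d (suc t) + ιK (suc t) * stirlingA d t
        ≈⟨ +-cong (*-congˡ (stirlingA-vanish (ℕ.m<n⇒m<1+n d<t))) (*-congˡ (stirlingA-vanish d<t)) ⟩
      ιK (suc (suc t)) * 0# + ιK (suc t) * 0#                           ≈⟨ solve 2 (λ x y → x :* con (+ 0) :+ y :* con (+ 0) := con (+ 0)) refl _ _ ⟩
      0#                                                                ∎

    -- For j = suc d the exponents are both 0 and it is stirlingA d j that vanishes.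
    ^∸-stirlingA : ∀ x {d j} → j ≤ suc d → x ^ (suc d ∸ j) * stirlingA d j ≈ x * (x ^ (d ∸ j) * stirlingA d j)
    ^∸-stirlingA x {d} {j} j≤1+d with ℕ.m≤n⇒m<n∨m≡n j≤1+d
    ... | inj₁ (s≤s j≤d) = trans (*-congʳ (reflexive (≡.cong (x ^_) (ℕ.+-∸-assoc 1 j≤d)))) (*-assoc _ _ _)
    ... | inj₂ ≡.refl    = trans (*-congˡ A≈0) (trans (zeroʳ _) (sym (trans (*-congˡ (trans (*-congˡ A≈0) (zeroʳ _))) (zeroʳ _))))
      where A≈0 = stirlingA-vanish (ℕ.n<1+n d)

    stirlingA-reverse : ∀ e j → sumTo j (λ i → sgn i * (ιK (j C i) * ιK (suc i ℕ.^ e))) ≈ sgn j * stirlingA e j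
    stirlingA-reverse e j = sym (begin
      sgn j * stirlingA e j                                         ≈⟨ *-congˡ (sumTo-reverse j _) ⟩
      sgn j * sumTo j (λ i → sgn (j ∸ i) * (ιK (j C (j ∸ i)) * ιK ((suc j ∸ (j ∸ i)) ℕ.^ e)))
        ≈⟨ sumTo-*ˡ j (sgn j) _ ⟩
      sumTo j (λ i → sgn j * (sgn (j ∸ i) * (ιK (j C (j ∸ i)) * ιK ((suc j ∸ (j ∸ i)) ℕ.^ e))))
        ≈⟨ sumTo-cong j reflect ⟩
      sumTo j (λ i → sgn i * (ιK (j C i) * ιK (suc i ℕ.^ e)))        ∎)
      where
      reflect : ∀ i → i ≤ j →
        sgn j * (sgn (j ∸ i) * (ιK (j C (j ∸ i)) * ιK ((suc j ∸ (j ∸ i)) ℕ.^ e))) ≈ sgn i * (ιK (j C i) * ιK (suc i ℕ.^ e))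
      reflect i i≤j = begin
        sgn j * (sgn (j ∸ i) * (ιK (j C (j ∸ i)) * ιK ((suc j ∸ (j ∸ i)) ℕ.^ e)))
          ≈⟨ *-cong sgn-split (*-congˡ (*-cong (ι-cong (≡.sym (nCk≡nC[n∸k] i≤j))) (ι-cong (≡.cong (ℕ._^ e) 1+j∸[j∸i]≡1+i)))) ⟩
        sgn i * sgn (j ∸ i) * (sgn (j ∸ i) * (ιK (j C i) * ιK (suc i ℕ.^ e)))
          ≈⟨ solve 3 (λ a s x → a :* s :* (s :* x) := a :* (s :* s) :* x) refl (sgn i) (sgn (j ∸ i)) _ ⟩
        sgn i * (sgn (j ∸ i) * sgn (j ∸ i)) * (ιK (j C i) * ιK (suc i ℕ.^ e))
          ≈⟨ *-congʳ (trans (*-congˡ (sgn-square (j ∸ i))) (*-identityʳ _)) ⟩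
        sgn i * (ιK (j C i) * ιK (suc i ℕ.^ e))                        ∎
        where
        sgn-split : sgn j ≈ sgn i * sgn (j ∸ i)
        sgn-split = trans (reflexive (≡.cong sgn (≡.sym (ℕ.m+[n∸m]≡n i≤j)))) (^-+ (- 1#) i (j ∸ i))
        1+j∸[j∸i]≡1+i : suc j ∸ (j ∸ i) ≡.≡ suc i
        1+j∸[j∸i]≡1+i = ≡.trans (ℕ.+-∸-assoc 1 (ℕ.m∸n≤m j i)) (≡.cong suc (ℕ.m∸[m∸n]≡n i≤j))


  module PowerSeries where
    open FieldArithmetic
    open FiniteSums
    open ℤ-CoefficientSolver cring
    open import Algebra.Properties.Ring ring using (-0#≈0#)
    open import Relation.Binary.Reasoning.Setoid setoid

    ≋-refl : ∀ {f} → f ≋ f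
    ≋-refl _ = refl

    ≋-sym : ∀ {f g} → f ≋ g → g ≋ f
    ≋-sym f≋g n = sym (f≋g n)

    ≋-trans : ∀ {f g h} → f ≋ g → g ≋ h → f ≋ h
    ≋-trans f≋g g≋h n = trans (f≋g n) (g≋h n)

    cst : Carrier → PS
    cst a zero    = a
    cst a (suc _) = 0#

    tail : PS → PS
    tail f n = f (suc n)

    ⊕-cong : ∀ {f f′ g g′} → f ≋ f′ → g ≋ g′ → (f ⊕ g) ≋ (f′ ⊕ g′)
    ⊕-cong f≋f′ g≋g′ n = +-cong (f≋f′ n) (g≋g′ n)

    ⊙-cong : ∀ {a b f g} → a ≈ b → f ≋ g → (a ⊙ f) ≋ (b ⊙ g)
    ⊙-cong a≈b f≋g n = *-cong a≈b (f≋g n)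

    ⊛-cong : ∀ {f f′ g g′} → f ≋ f′ → g ≋ g′ → (f ⊛ g) ≋ (f′ ⊛ g′)
    ⊛-cong f≋f′ g≋g′ n = sumTo-cong n (λ i _ → *-cong (f≋f′ i) (g≋g′ (n ∸ i)))

    ⊛-congˡ : ∀ f {g g′} → g ≋ g′ → (f ⊛ g) ≋ (f ⊛ g′)
    ⊛-congˡ f = ⊛-cong {f} ≋-refl

    ⊛-congʳ : ∀ g {f f′} → f ≋ f′ → (f ⊛ g) ≋ (f′ ⊛ g)
    ⊛-congʳ g f≋f′ = ⊛-cong {g = g} f≋f′ ≋-refl

    ⊛-comm : ∀ f g → (f ⊛ g) ≋ (g ⊛ f)
    ⊛-comm f g n = trans (sumTo-reverse n _)
      (sumTo-cong n (λ i i≤n → trans (*-comm _ _) (*-congʳ (reflexive (≡.cong g (ℕ.m∸[m∸n]≡n i≤n))))))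

    ⊛-suc : ∀ f g n → (f ⊛ g) (suc n) ≈ f 0 * g (suc n) + (tail f ⊛ g) n
    ⊛-suc f g n = sumTo-suc n _

    ⊛-distribˡ : ∀ f g h → (f ⊛ (g ⊕ h)) ≋ ((f ⊛ g) ⊕ (f ⊛ h))
    ⊛-distribˡ f g h n = trans (sumTo-cong n (λ i _ → distribˡ _ _ _)) (sumTo-+ n _ _)

    ⊛-distribʳ : ∀ f g h → ((g ⊕ h) ⊛ f) ≋ ((g ⊛ f) ⊕ (h ⊛ f))
    ⊛-distribʳ f g h n = trans (sumTo-cong n (λ i _ → distribʳ _ _ _)) (sumTo-+ n _ _)

    ⊙-⊛ : ∀ a f g → ((a ⊙ f) ⊛ g) ≋ (a ⊙ (f ⊛ g))
    ⊙-⊛ a f g n = trans (sumTo-cong n (λ i _ → *-assoc _ _ _)) (sym (sumTo-*ˡ n a _))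

    ⊛-assoc : ∀ f g h → ((f ⊛ g) ⊛ h) ≋ (f ⊛ (g ⊛ h))
    ⊛-assoc f g h zero    = *-assoc _ _ _
    ⊛-assoc f g h (suc n) = begin
      ((f ⊛ g) ⊛ h) (suc n)                                              ≈⟨ ⊛-suc (f ⊛ g) h n ⟩
      f 0 * g 0 * h (suc n) + (tail (f ⊛ g) ⊛ h) n
        ≈⟨ +-congˡ (⊛-cong {g = h} (⊛-suc f g) ≋-refl n) ⟩
      f 0 * g 0 * h (suc n) + (((f 0 ⊙ tail g) ⊕ (tail f ⊛ g)) ⊛ h) n      ≈⟨ +-congˡ (⊛-distribʳ h _ _ n) ⟩
      f 0 * g 0 * h (suc n) + (((f 0 ⊙ tail g) ⊛ h) n + ((tail f ⊛ g) ⊛ h) n)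
        ≈⟨ +-congˡ (+-cong (⊙-⊛ (f 0) (tail g) h n) (⊛-assoc (tail f) g h n)) ⟩
      f 0 * g 0 * h (suc n) + (f 0 * (tail g ⊛ h) n + (tail f ⊛ (g ⊛ h)) n)
        ≈⟨ solve 5 (λ a b c x y → a :* b :* c :+ (a :* x :+ y) := a :* (b :* c :+ x) :+ y) refl _ _ _ _ _ ⟩
      f 0 * (g 0 * h (suc n) + (tail g ⊛ h) n) + (tail f ⊛ (g ⊛ h)) n      ≈⟨ +-congʳ (*-congˡ (⊛-suc g h n)) ⟨
      f 0 * (g ⊛ h) (suc n) + (tail f ⊛ (g ⊛ h)) n                        ≈⟨ ⊛-suc f (g ⊛ h) n ⟨
      (f ⊛ (g ⊛ h)) (suc n)                                              ∎

    cst-⊛ : ∀ a f → (cst a ⊛ f) ≋ (a ⊙ f)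
    cst-⊛ a f zero    = refl
    cst-⊛ a f (suc n) = trans (⊛-suc (cst a) f n) (trans (+-congˡ (sumTo-zero n (λ i _ → zeroˡ _))) (+-identityʳ _))

    oneS≋cst1 : oneS ≋ cst 1#
    oneS≋cst1 zero    = refl
    oneS≋cst1 (suc n) = refl

    oneS-⊛ : ∀ f → (oneS ⊛ f) ≋ f
    oneS-⊛ f n = trans (⊛-cong {g = f} oneS≋cst1 ≋-refl n) (trans (cst-⊛ 1# f n) (*-identityˡ _))

    ⊛-oneS : ∀ f → (f ⊛ oneS) ≋ f
    ⊛-oneS f = ≋-trans (⊛-comm f oneS) (oneS-⊛ f)

    PS-commutativeRing : CommutativeRing c ℓ
    PS-commutativeRing = record
      { Carrier = PS
      ; _≈_ = _≋_
      ; _+_ = _⊕_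
      ; _*_ = _⊛_
      ; -_ = λ f n → - f n
      ; 0# = λ _ → 0#
      ; 1# = oneS
      ; isCommutativeRing = record
        { isRing = record
          { +-isAbelianGroup = record
            { isGroup = record
              { isMonoid = record
                { isSemigroup = record
                  { isMagma = record
                    { isEquivalence = record { refl = ≋-refl ; sym = ≋-sym ; trans = ≋-trans }
                    ; ∙-cong = ⊕-cong
                    }
                  ; assoc = λ f g h n → +-assoc _ _ _
                  }
                ; identity = (λ f n → +-identityˡ _) , (λ f n → +-identityʳ _)
                }
              ; inverse = (λ f n → -‿inverseˡ _) , (λ f n → -‿inverseʳ _)
              ; ⁻¹-cong = λ f≋g n → -‿cong (f≋g n)
              }
            ; comm = λ f g n → +-comm _ _
            }
          ; *-cong = ⊛-cong
          ; *-assoc = ⊛-assoc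
          ; *-identity = oneS-⊛ , ⊛-oneS
          ; distrib = ⊛-distribˡ , ⊛-distribʳ
          }
        ; *-comm = ⊛-comm
        }
      }

    cst-cong : ∀ {a b} → a ≈ b → cst a ≋ cst b
    cst-cong a≈b zero    = a≈b
    cst-cong a≈b (suc n) = refl

    cst-+ : ∀ a b → cst (a + b) ≋ (cst a ⊕ cst b)
    cst-+ a b zero    = refl
    cst-+ a b (suc n) = sym (+-identityˡ 0#)

    cst-* : ∀ a b → cst (a * b) ≋ (cst a ⊛ cst b)
    cst-* a b = ≋-sym (≋-trans (cst-⊛ a (cst b)) scaled)
      where
      scaled : (a ⊙ cst b) ≋ cst (a * b)
      scaled zero    = refl
      scaled (suc n) = zeroʳ a

    cst-neg : ∀ a → cst (- a) ≋ (λ n → - cst a n)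
    cst-neg a zero    = refl
    cst-neg a (suc n) = sym -0#≈0#

    cst-ι : ∀ n → cst (ιK n) ≋ ι PS-commutativeRing n
    cst-ι zero    zero    = refl
    cst-ι zero    (suc _) = refl
    cst-ι (suc n) = ≋-trans (cst-+ 1# (ιK n)) (⊕-cong (≋-sym oneS≋cst1) (cst-ι n))

    ⊛-⊙ : ∀ a f g → (f ⊛ (a ⊙ g)) ≋ (a ⊙ (f ⊛ g))
    ⊛-⊙ a f g = ≋-trans (⊛-comm f (a ⊙ g)) (≋-trans (⊙-⊛ a g f) (⊙-cong refl (⊛-comm g f)))

    lin-⊛ : ∀ a b f n → (lin a b ⊛ f) (suc n) ≈ a * f (suc n) + b * f n
    lin-⊛ a b f zero    = refl
    lin-⊛ a b f (suc n) = trans (⊛-suc (lin a b) f (suc n))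
      (+-congˡ (trans (⊛-suc (tail (lin a b)) f n) (trans (+-congˡ (sumTo-zero n (λ i _ → zeroˡ _))) (+-identityʳ _))))

    deriv-cong : ∀ {f g} → f ≋ g → deriv f ≋ deriv g
    deriv-cong f≋g n = *-congˡ (f≋g (suc n))

    deriv-⊕ : ∀ f g → deriv (f ⊕ g) ≋ (deriv f ⊕ deriv g)
    deriv-⊕ f g n = distribˡ _ _ _

    deriv-⊙ : ∀ a f → deriv (a ⊙ f) ≋ (a ⊙ deriv f)
    deriv-⊙ a f n = solve 3 (λ i a x → i :* (a :* x) := a :* (i :* x)) refl (ιK (suc n)) a (f (suc n))

    deriv-⊛ : ∀ f g → deriv (f ⊛ g) ≋ ((deriv f ⊛ g) ⊕ (f ⊛ deriv g))
    deriv-⊛ f g n = begin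
      ιK (suc n) * sumTo (suc n) (λ i → f i * g (suc n ∸ i))           ≈⟨ sumTo-*ˡ (suc n) _ _ ⟩
      sumTo (suc n) (λ i → ιK (suc n) * (f i * g (suc n ∸ i)))         ≈⟨ sumTo-cong (suc n) split ⟩
      sumTo (suc n) (λ i → ιK i * f i * g (suc n ∸ i) + f i * (ιK (suc n ∸ i) * g (suc n ∸ i))) ≈⟨ sumTo-+ (suc n) _ _ ⟩
      sumTo (suc n) (λ i → ιK i * f i * g (suc n ∸ i)) + sumTo (suc n) (λ i → f i * (ιK (suc n ∸ i) * g (suc n ∸ i)))
        ≈⟨ +-cong left right ⟩
      (deriv f ⊛ g) n + (f ⊛ deriv g) n                                ∎
      where
      split : ∀ i → i ≤ suc n →
        ιK (suc n) * (f i * g (suc n ∸ i)) ≈ ιK i * f i * g (suc n ∸ i) + f i * (ιK (suc n ∸ i) * g (suc n ∸ i))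
      split i i≤1+n = begin
        ιK (suc n) * (f i * g (suc n ∸ i))                   ≈⟨ *-congʳ (ι-cong (ℕ.m+[n∸m]≡n i≤1+n)) ⟨
        ιK (i ℕ.+ (suc n ∸ i)) * (f i * g (suc n ∸ i))       ≈⟨ *-congʳ (ι-+ i (suc n ∸ i)) ⟩
        (ιK i + ιK (suc n ∸ i)) * (f i * g (suc n ∸ i))
          ≈⟨ solve 4 (λ a b x y → (a :+ b) :* (x :* y) := a :* x :* y :+ x :* (b :* y)) refl _ _ _ _ ⟩
        ιK i * f i * g (suc n ∸ i) + f i * (ιK (suc n ∸ i) * g (suc n ∸ i)) ∎
      left : sumTo (suc n) (λ i → ιK i * f i * g (suc n ∸ i)) ≈ (deriv f ⊛ g) n
      left = trans (sumTo-suc n _) (trans (+-congʳ (trans (*-congʳ (zeroˡ _)) (zeroˡ _))) (+-identityˡ _))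
      right : sumTo (suc n) (λ i → f i * (ιK (suc n ∸ i) * g (suc n ∸ i))) ≈ (f ⊛ deriv g) n
      right = trans (+-congˡ (trans (*-congˡ (trans (*-congʳ (ι-cong (ℕ.n∸n≡0 n))) (zeroˡ _))) (zeroʳ _)))
        (trans (+-identityʳ _)
          (sumTo-cong n (λ i i≤n → *-congˡ (reflexive (≡.cong (λ m → ιK m * g m) (ℕ.+-∸-assoc 1 i≤n))))))

    deriv-^S : ∀ f m → deriv (f ^S suc m) ≋ (ιK (suc m) ⊙ ((f ^S m) ⊛ deriv f))
    deriv-^S f zero    n = begin
      deriv (f ⊛ oneS) n             ≈⟨ deriv-cong (⊛-oneS f) n ⟩
      deriv f n                      ≈⟨ oneS-⊛ (deriv f) n ⟨
      (oneS ⊛ deriv f) n             ≈⟨ solve 1 (λ x → x := con (+ 1) :* x) refl _ ⟩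
      ιK 1 * (oneS ⊛ deriv f) n      ∎
    deriv-^S f (suc m) n = begin
      deriv (f ⊛ (f ^S suc m)) n
        ≈⟨ deriv-⊛ f (f ^S suc m) n ⟩
      (deriv f ⊛ (f ^S suc m)) n + (f ⊛ deriv (f ^S suc m)) n
        ≈⟨ +-cong (⊛-comm (deriv f) (f ^S suc m) n) (⊛-congˡ f (deriv-^S f m) n) ⟩
      ((f ^S suc m) ⊛ deriv f) n + (f ⊛ (ιK (suc m) ⊙ ((f ^S m) ⊛ deriv f))) n
        ≈⟨ +-congˡ (trans (⊛-⊙ (ιK (suc m)) f ((f ^S m) ⊛ deriv f) n) (*-congˡ (≋-sym (⊛-assoc f (f ^S m) (deriv f)) n))) ⟩
      ((f ^S suc m) ⊛ deriv f) n + ιK (suc m) * ((f ^S suc m) ⊛ deriv f) n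
        ≈⟨ trans (distribʳ _ 1# (ιK (suc m))) (+-congʳ (*-identityˡ _)) ⟨
      ιK (suc (suc m)) * ((f ^S suc m) ⊛ deriv f) n ∎

    geometric : Carrier → PS
    geometric x n = x ^ n

    geometric-inverse : ∀ x → (lin 1# (- x) ⊛ geometric x) ≋ oneS
    geometric-inverse x zero    = *-identityˡ 1#
    geometric-inverse x (suc n) = trans (lin-⊛ 1# (- x) (geometric x) n)
      (trans (+-congʳ (*-identityˡ _)) (solve 2 (λ x p → x :* p :+ :- x :* p := con (+ 0)) refl x (x ^ n)))

    deriv-geometric : ∀ x → deriv (geometric x) ≋ (x ⊙ (geometric x ⊛ geometric x))
    deriv-geometric x n = begin
      ιK (suc n) * (x * x ^ n)                   ≈⟨ solve 3 (λ i x p → i :* (x :* p) := x :* (i :* p)) refl (ιK (suc n)) x (x ^ n) ⟩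
      x * (ιK (suc n) * x ^ n)                   ≈⟨ *-congˡ (sumTo-const n (x ^ n)) ⟨
      x * sumTo n (λ _ → x ^ n)                  ≈⟨ *-congˡ (sumTo-cong n (λ i i≤n → sym (split i i≤n))) ⟩
      x * (geometric x ⊛ geometric x) n          ∎
      where
      split : ∀ i → i ≤ n → x ^ i * x ^ (n ∸ i) ≈ x ^ n
      split i i≤n = trans (sym (^-+ x i (n ∸ i))) (reflexive (≡.cong (x ^_) (ℕ.m+[n∸m]≡n i≤n)))

    geometric-⊛ : ∀ x y n → (x - y) * (geometric x ⊛ geometric y) n ≈ x ^ suc n - y ^ suc n
    geometric-⊛ x y zero    = trans (trans (*-congˡ (*-identityˡ 1#)) (*-identityʳ _))
      (sym (+-cong (*-identityʳ x) (-‿cong (*-identityʳ y))))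
    geometric-⊛ x y (suc n) = begin
      (x - y) * (geometric x ⊛ geometric y) (suc n)
        ≈⟨ *-congˡ (trans (⊛-suc (geometric x) (geometric y) n) (+-cong (*-identityˡ _) (⊙-⊛ x (geometric x) (geometric y) n))) ⟩
      (x - y) * (y ^ suc n + x * (geometric x ⊛ geometric y) n)
        ≈⟨ solve 4 (λ x y p h → (x :- y) :* (p :+ x :* h) := (x :- y) :* p :+ x :* ((x :- y) :* h)) refl x y (y ^ suc n) _ ⟩
      (x - y) * y ^ suc n + x * ((x - y) * (geometric x ⊛ geometric y) n)
        ≈⟨ +-congˡ (*-congˡ (geometric-⊛ x y n)) ⟩
      (x - y) * (y * y ^ n) + x * (x * x ^ n - y * y ^ n)
        ≈⟨ solve 4 (λ x y p q → (x :- y) :* (y :* q) :+ x :* (x :* p :- y :* q) := x :* (x :* p) :- y :* (y :* q)) refl x y (x ^ n) (y ^ n) ⟩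
      x ^ suc (suc n) - y ^ suc (suc n) ∎


  module EulerOperator (h : PS) where
    open FieldArithmetic
    open FiniteSums
    open PowerSeries
    private module ℙ = CommutativeRing PS-commutativeRing
    open import Algebra.Properties.CommutativeSemigroup ℙ.*-commutativeSemigroup using (x∙yz≈y∙xz)

    Θ : PS → PS
    Θ f = h ⊛ deriv f

    Θ-cong : ∀ {f g} → f ≋ g → Θ f ≋ Θ g
    Θ-cong f≋g = ⊛-congˡ h (deriv-cong f≋g)

    Θ-⊕ : ∀ f g → Θ (f ⊕ g) ≋ (Θ f ⊕ Θ g)
    Θ-⊕ f g = ≋-trans (⊛-congˡ h (deriv-⊕ f g)) (⊛-distribˡ h (deriv f) (deriv g))

    Θ-⊙ : ∀ a f → Θ (a ⊙ f) ≋ (a ⊙ Θ f)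
    Θ-⊙ a f = ≋-trans (⊛-congˡ h (deriv-⊙ a f)) (⊛-⊙ a h (deriv f))

    Θ-sumS : ∀ d (φ : ℕ → PS) → Θ (sumS d φ) ≋ sumS d (λ j → Θ (φ j))
    Θ-sumS zero    φ = ≋-refl
    Θ-sumS (suc d) φ = ≋-trans (Θ-⊕ (sumS d φ) (φ (suc d))) (⊕-cong (Θ-sumS d φ) ≋-refl)

    Θ^ : ℕ → PS → PS
    Θ^ zero    f = f
    Θ^ (suc d) f = Θ (Θ^ d f)

    Θ^-cong : ∀ d {f g} → f ≋ g → Θ^ d f ≋ Θ^ d g
    Θ^-cong zero    f≋g = f≋g
    Θ^-cong (suc d) f≋g = Θ-cong (Θ^-cong d f≋g)

    Θ^-suc : ∀ d f → Θ^ (suc d) f ≋ Θ^ d (Θ f)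
    Θ^-suc zero    f = ≋-refl
    Θ^-suc (suc d) f = Θ-cong (Θ^-suc d f)

    Θ-^S : ∀ f m → Θ (f ^S suc m) ≋ (ιK (suc m) ⊙ ((f ^S m) ⊛ Θ f))
    Θ-^S f m = ≋-trans (⊛-congˡ h (deriv-^S f m))
      (≋-trans (⊛-⊙ (ιK (suc m)) h ((f ^S m) ⊛ deriv f)) (⊙-cong refl (x∙yz≈y∙xz h (f ^S m) (deriv f))))

    Θ-h^S : ∀ {a} → deriv h ≋ cst a → ∀ j f →
      Θ ((h ^S suc j) ⊛ f) ≋ (((ιK (suc j) * a) ⊙ ((h ^S suc j) ⊛ f)) ⊕ ((h ^S suc (suc j)) ⊛ deriv f))
    Θ-h^S {a} h′≋a j f = begin
      h ⊛ deriv ((h ^S suc j) ⊛ f)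
        ≈⟨ ⊛-congˡ h (≋-trans (deriv-⊛ (h ^S suc j) f) (⊕-cong (⊛-congʳ f deriv-h^S) ≋-refl)) ⟩
      h ⊛ (((cj ⊛ ((h ^S j) ⊛ cst a)) ⊛ f) ⊕ ((h ^S suc j) ⊛ deriv f))
        ≈⟨ solve 6 (λ h c H A f f′ → h :* ((c :* (H :* A)) :* f :+ (h :* H) :* f′) := (c :* A) :* ((h :* H) :* f) :+ (h :* (h :* H)) :* f′)
             ≋-refl h cj (h ^S j) (cst a) f (deriv f) ⟩
      ((cj ⊛ cst a) ⊛ ((h ^S suc j) ⊛ f)) ⊕ ((h ^S suc (suc j)) ⊛ deriv f)
        ≈⟨ ⊕-cong (≋-trans (⊛-congʳ ((h ^S suc j) ⊛ f) (≋-sym (cst-* (ιK (suc j)) a)))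
                           (cst-⊛ (ιK (suc j) * a) ((h ^S suc j) ⊛ f))) ≋-refl ⟩
      ((ιK (suc j) * a) ⊙ ((h ^S suc j) ⊛ f)) ⊕ ((h ^S suc (suc j)) ⊛ deriv f) ∎
      where
      open import Relation.Binary.Reasoning.Setoid ℙ.setoid
      open ℤ-CoefficientSolver PS-commutativeRing
      cj : PS
      cj = cst (ιK (suc j))
      deriv-h^S : deriv (h ^S suc j) ≋ (cj ⊛ ((h ^S j) ⊛ cst a))
      deriv-h^S = ≋-trans (deriv-^S h j) (≋-trans (≋-sym (cst-⊛ (ιK (suc j)) ((h ^S j) ⊛ deriv h)))
        (⊛-congˡ cj (⊛-congˡ (h ^S j) h′≋a)))

    module Tridiagonal (φ : ℕ → PS) (ρ σ : ℕ → Carrier)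
                       (Θφ : ∀ j → Θ (φ j) ≋ ((ρ j ⊙ φ j) ⊕ (σ j ⊙ φ (suc j)))) where

      combination : ℕ → (ℕ → Carrier) → PS
      combination d γ = sumS d (λ j → γ j ⊙ φ j)

      advance : (ℕ → Carrier) → ℕ → Carrier
      advance γ zero    = ρ 0 * γ 0
      advance γ (suc j) = ρ (suc j) * γ (suc j) + σ j * γ j

      combination-cong : ∀ d {γ δ} → (∀ j → j ≤ d → γ j ≈ δ j) → combination d γ ≋ combination d δ
      combination-cong d γ≈δ n = sumTo-cong d (λ j j≤d → *-congʳ (γ≈δ j j≤d))

      Θ-combination : ∀ d γ → γ (suc d) ≈ 0# → Θ (combination d γ) ≋ combination (suc d) (advance γ)
      Θ-combination d γ γ₁₊d≈0 n = begin
        Θ (combination d γ) n                        ≈⟨ Θ-sumS d (λ j → γ j ⊙ φ j) n ⟩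
        sumTo d (λ j → Θ (γ j ⊙ φ j) n)               ≈⟨ sumTo-cong d (λ j _ → trans (Θ-⊙ (γ j) (φ j) n) (*-congˡ (Θφ j n))) ⟩
        sumTo d (λ j → γ j * (ρ j * φ j n + σ j * φ (suc j) n))
          ≈⟨ sumTo-cong d (λ j _ → solve 5 (λ g r s x y → g :* (r :* x :+ s :* y) := r :* g :* x :+ s :* g :* y) refl _ _ _ _ _) ⟩
        sumTo d (λ j → x j + z j)                     ≈⟨ sumTo-+ d x z ⟩
        sumTo d x + sumTo d z                         ≈⟨ +-congʳ (+-identityʳ _) ⟨
        sumTo d x + 0# + sumTo d z                    ≈⟨ +-congʳ (+-congˡ x₁₊d≈0) ⟨
        sumTo (suc d) x + sumTo d z                   ≈⟨ +-congʳ (sumTo-suc d x) ⟩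
        x 0 + sumTo d (λ j → x (suc j)) + sumTo d z   ≈⟨ +-assoc _ _ _ ⟩
        x 0 + (sumTo d (λ j → x (suc j)) + sumTo d z) ≈⟨ +-congˡ (sumTo-+ d _ z) ⟨
        x 0 + sumTo d (λ j → x (suc j) + z j)         ≈⟨ +-congˡ (sumTo-cong d (λ j _ → distribʳ _ _ _)) ⟨
        x 0 + sumTo d (λ j → advance γ (suc j) * φ (suc j) n) ≈⟨ sumTo-suc d _ ⟨
        combination (suc d) (advance γ) n             ∎
        where
        open import Relation.Binary.Reasoning.Setoid setoid
        open ℤ-CoefficientSolver cring
        x z : ℕ → Carrier
        x j = ρ j * γ j * φ j n
        z j = σ j * γ j * φ (suc j) n
        x₁₊d≈0 : x (suc d) ≈ 0#
        x₁₊d≈0 = trans (*-congʳ (trans (*-congˡ γ₁₊d≈0) (zeroʳ _))) (zeroˡ _)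

      combination-orbit : (γ : ℕ → ℕ → Carrier) →
        (∀ d j → j ≤ suc d → γ (suc d) j ≈ advance (γ d) j) → (∀ d → γ d (suc d) ≈ 0#) →
        ∀ d → combination d (γ d) ≋ Θ^ d (combination 0 (γ 0))
      combination-orbit γ recurrence vanishing zero    = ≋-refl
      combination-orbit γ recurrence vanishing (suc d) =
        ≋-trans (combination-cong (suc d) (recurrence d))
          (≋-trans (≋-sym (Θ-combination d (γ d) (vanishing d)))
            (Θ-cong (combination-orbit γ recurrence vanishing d)))


  module LucasGeneratingFunction (α β : Carrier) (α≉β : ¬ (α - β ≈ 0#)) (k : ℕ) where
    open Lucas α β α≉β
    open FieldArithmetic
    open PowerSeries
    private
      module ℙ = CommutativeRing PS-commutativeRing
      module Scalar where
        open import Relation.Binary.Reasoning.Setoid setoid public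
        open ℤ-CoefficientSolver cring public

    a b : Carrier
    a = α ^ k
    b = β ^ k

    q^k≈ab : q ^ k ≈ a * b
    q^k≈ab = *-^ α β k

    H : PS
    H = geometric a ⊛ geometric b

    F≋U⊙H : F k ≋ (U k ⊙ H)
    F≋U⊙H n = begin
      (α ^ (suc n ℕ.* k) - β ^ (suc n ℕ.* k)) * iδ ≈⟨ *-congʳ (+-cong (^-* α (suc n) k) (-‿cong (^-* β (suc n) k))) ⟩
      (a ^ suc n - b ^ suc n) * iδ                ≈⟨ *-congʳ (geometric-⊛ a b n) ⟨
      (a - b) * H n * iδ                          ≈⟨ solve 3 (λ x h i → x :* h :* i := x :* i :* h) refl (a - b) (H n) iδ ⟩
      U k * H n                                   ∎
      where
      open Scalar
      iδ = inv (α - β) α≉β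

    Q₂ m₄ : Carrier
    Q₂ = ι cring 2 * q ^ k
    m₄ = ι cring 4 * q ^ k

    g : PS
    g = lin (V k) (- Q₂)

    deriv-g : deriv g ≋ cst (- Q₂)
    deriv-g zero    = solve 1 (λ x → con (+ 1) :* x := x) refl (- Q₂)
      where open Scalar
    deriv-g (suc n) = zeroʳ _

    open EulerOperator g public

    g-split : g ≋ ((a ⊙ lin 1# (- b)) ⊕ (b ⊙ lin 1# (- a)))
    g-split zero          = sym (+-cong (*-identityʳ a) (*-identityʳ b))
    g-split (suc zero)    = trans (-‿cong (*-congˡ q^k≈ab))
      (solve 2 (λ a b → :- (con (+ 2) :* (a :* b)) := a :* :- b :+ b :* :- a) refl a b)
      where open Scalar
    g-split (suc (suc n)) = solve 2 (λ a b → con (+ 0) := a :* con (+ 0) :+ b :* con (+ 0)) refl a b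
      where open Scalar

    a-b-split : cst (a - b) ≋ ((a ⊙ lin 1# (- b)) ⊕ ((- b) ⊙ lin 1# (- a)))
    a-b-split zero          = sym (+-cong (*-identityʳ a) (*-identityʳ (- b)))
    a-b-split (suc zero)    = solve 2 (λ a b → con (+ 0) := a :* :- b :+ :- b :* :- a) refl a b
      where open Scalar
    a-b-split (suc (suc n)) = solve 2 (λ a b → con (+ 0) := a :* con (+ 0) :+ :- b :* con (+ 0)) refl a b
      where open Scalar

    -- Θ H = g H′ = (g H)², and (g H)² − ((a − b) H)² = 4ab H.
    Θ-H : Θ H ≋ ((((a - b) * (a - b)) ⊙ (H ⊛ H)) ⊕ (m₄ ⊙ H))
    Θ-H = begin
      g ⊛ deriv H                              ≈⟨ ⊛-cong g≋ deriv-H ⟩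
      ((Ca ⊛ Lb) ⊕ (Cb ⊛ La)) ⊛ (H ⊛ S)           ≈⟨ ⊛-assoc ((Ca ⊛ Lb) ⊕ (Cb ⊛ La)) H S ⟨
      (((Ca ⊛ Lb) ⊕ (Cb ⊛ La)) ⊛ H) ⊛ S           ≈⟨ ⊛-congʳ S (fractions Ca Cb) ⟩
      S ⊛ S
        ≈⟨ solve 4 (λ Ca Cb Ga Gb → (Ca :* Ga :+ Cb :* Gb) :* (Ca :* Ga :+ Cb :* Gb)
                               := (Ca :* Ga :+ :- Cb :* Gb) :* (Ca :* Ga :+ :- Cb :* Gb) :+ con (+ 4) :* Ca :* Cb :* (Ga :* Gb))
             ≋-refl Ca Cb (geometric a) (geometric b) ⟩
      (D ⊛ D) ⊕ (((ι PS-commutativeRing 4 ⊛ Ca) ⊛ Cb) ⊛ H)  ≈⟨ ⊕-cong (⊛-cong D≋δH D≋δH) (⊛-congʳ H four-ab) ⟩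
      ((δ ⊛ H) ⊛ (δ ⊛ H)) ⊕ (cst m₄ ⊛ H)
        ≈⟨ ⊕-cong (≋-trans (solve 2 (λ δ H → (δ :* H) :* (δ :* H) := (δ :* δ) :* (H :* H)) ≋-refl δ H)
                            (⊛-congʳ (H ⊛ H) (≋-sym (cst-* (a - b) (a - b))))) ≋-refl ⟩
      (cst ((a - b) * (a - b)) ⊛ (H ⊛ H)) ⊕ (cst m₄ ⊛ H)
        ≈⟨ ⊕-cong (cst-⊛ ((a - b) * (a - b)) (H ⊛ H)) (cst-⊛ m₄ H) ⟩
      (((a - b) * (a - b)) ⊙ (H ⊛ H)) ⊕ (m₄ ⊙ H) ∎
      where
      open import Relation.Binary.Reasoning.Setoid ℙ.setoid
      open ℤ-CoefficientSolver PS-commutativeRing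
      Ca Cb La Lb S D δ : PS
      Ca  = cst a
      Cb  = cst b
      La = lin 1# (- a)
      Lb = lin 1# (- b)
      S  = (Ca ⊛ geometric a) ⊕ (Cb ⊛ geometric b)
      D  = (Ca ⊛ geometric a) ⊕ ((ℙ.- Cb) ⊛ geometric b)
      δ  = cst (a - b)
      LaGa≋1 : (La ⊛ geometric a) ≋ oneS
      LaGa≋1 = geometric-inverse a
      LbGb≋1 : (Lb ⊛ geometric b) ≋ oneS
      LbGb≋1 = geometric-inverse b
      fractions : ∀ x y → (((x ⊛ Lb) ⊕ (y ⊛ La)) ⊛ H) ≋ ((x ⊛ geometric a) ⊕ (y ⊛ geometric b))
      fractions = add-fractions PS-commutativeRing {La} {geometric a} {Lb} {geometric b} LaGa≋1 LbGb≋1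
      g≋ : g ≋ ((Ca ⊛ Lb) ⊕ (Cb ⊛ La))
      g≋ = ≋-trans g-split (⊕-cong (≋-sym (cst-⊛ a Lb)) (≋-sym (cst-⊛ b La)))
      δ≋ : δ ≋ ((Ca ⊛ Lb) ⊕ ((ℙ.- Cb) ⊛ La))
      δ≋ = ≋-trans a-b-split (⊕-cong (≋-sym (cst-⊛ a Lb)) (≋-trans (≋-sym (cst-⊛ (- b) La)) (⊛-congʳ La (cst-neg b))))
      deriv-H : deriv H ≋ (H ⊛ S)
      deriv-H = ≋-trans (deriv-⊛ (geometric a) (geometric b))
        (≋-trans (⊕-cong (⊛-congʳ (geometric b) (≋-trans (deriv-geometric a) (≋-sym (cst-⊛ a _))))
                         (⊛-congˡ (geometric a) (≋-trans (deriv-geometric b) (≋-sym (cst-⊛ b _)))))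
          (solve 4 (λ Ca Cb Ga Gb → Ca :* (Ga :* Ga) :* Gb :+ Ga :* (Cb :* (Gb :* Gb)) := Ga :* Gb :* (Ca :* Ga :+ Cb :* Gb))
             ≋-refl Ca Cb (geometric a) (geometric b)))
      D≋δH : D ≋ (δ ⊛ H)
      D≋δH = ≋-sym (≋-trans (⊛-congʳ H δ≋) (fractions Ca (ℙ.- Cb)))
      four-ab : ((ι PS-commutativeRing 4 ⊛ Ca) ⊛ Cb) ≋ cst m₄
      four-ab = ≋-sym (≋-trans (cst-* (ι cring 4) (q ^ k))
        (≋-trans (⊛-cong (cst-ι 4) (≋-trans (cst-cong q^k≈ab) (cst-* a b))) (≋-sym (⊛-assoc (ι PS-commutativeRing 4) Ca Cb))))

    module _ (hU : ¬ (U k ≈ 0#)) where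
      open Scalar

      r : Carrier
      r = (V k * V k - m₄) * inv (U k) hU

      r*U : r * U k ≈ (a - b) * (a - b)
      r*U = begin
        (V k * V k - m₄) * inv (U k) hU * U k     ≈⟨ *-assoc _ _ _ ⟩
        (V k * V k - m₄) * (inv (U k) hU * U k)   ≈⟨ *-congˡ (trans (*-comm _ _) (inv-* (U k) hU)) ⟩
        (V k * V k - m₄) * 1#                     ≈⟨ *-identityʳ _ ⟩
        (a + b) * (a + b) - m₄                    ≈⟨ +-congˡ (-‿cong (*-congˡ q^k≈ab)) ⟩
        (a + b) * (a + b) - ι cring 4 * (a * b)
          ≈⟨ solve 2 (λ a b → (a :+ b) :* (a :+ b) :- con (+ 4) :* (a :* b) := (a :- b) :* (a :- b)) refl a b ⟩
        (a - b) * (a - b)                         ∎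

      riccati : Θ (F k) ≋ ((r ⊙ (F k ⊛ F k)) ⊕ (m₄ ⊙ F k))
      riccati n = begin
        Θ (F k) n                          ≈⟨ Θ-cong F≋U⊙H n ⟩
        Θ (U k ⊙ H) n                      ≈⟨ Θ-⊙ (U k) H n ⟩
        U k * Θ H n                        ≈⟨ *-congˡ (Θ-H n) ⟩
        U k * ((a - b) * (a - b) * (H ⊛ H) n + m₄ * H n)   ≈⟨ *-congˡ (+-congʳ (*-congʳ r*U)) ⟨
        U k * (r * U k * (H ⊛ H) n + m₄ * H n)
          ≈⟨ solve 5 (λ u r x m y → u :* (r :* u :* x :+ m :* y) := r :* (u :* u :* x) :+ m :* (u :* y)) refl (U k) r _ m₄ _ ⟩
        r * (U k * U k * (H ⊛ H) n) + m₄ * (U k * H n)   ≈⟨ +-cong (*-congˡ (sym (UH⊛UH n))) (*-congˡ (sym (F≋U⊙H n))) ⟩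
        r * (F k ⊛ F k) n + m₄ * F k n     ∎
        where
        UH⊛UH : (F k ⊛ F k) ≋ ((U k * U k) ⊙ (H ⊛ H))
        UH⊛UH = ≋-trans (⊛-cong F≋U⊙H F≋U⊙H)
          (≋-trans (⊙-⊛ (U k) H (U k ⊙ H)) (≋-trans (⊙-cong refl (⊛-⊙ (U k) H H)) (λ m → sym (*-assoc _ _ _))))


  module BothSidesAsOrbits (α β : Carrier) (α≉β : ¬ (α - β ≈ 0#)) (k : ℕ) (hU : ¬ (Lucas.U α β α≉β k ≈ 0#)) where
    open Lucas α β α≉β
    open FieldArithmetic
    open FiniteSums
    open StirlingCoefficients
    open PowerSeries
    open LucasGeneratingFunction α β α≉β k
    open ℤ-CoefficientSolver cring
    open import Relation.Binary.Reasoning.Setoid setoid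

    Θ-F^S : ∀ j → Θ (F k ^S suc j) ≋ (((ιK (suc j) * m₄) ⊙ (F k ^S suc j)) ⊕ ((ιK (suc j) * r hU) ⊙ (F k ^S suc (suc j))))
    Θ-F^S j = ≋-trans (Θ-^S (F k) j) (≋-trans (⊙-cong refl (⊛-congˡ (F k ^S j) (riccati hU))) pointwise)
      where
      Fʲ = F k ^S j
      reorder : (Fʲ ⊛ ((r hU ⊙ (F k ⊛ F k)) ⊕ (m₄ ⊙ F k))) ≋ ((m₄ ⊙ (F k ^S suc j)) ⊕ (r hU ⊙ (F k ^S suc (suc j))))
      reorder = ≋-trans (⊛-distribˡ Fʲ (r hU ⊙ (F k ⊛ F k)) (m₄ ⊙ F k))
        (≋-trans (⊕-cong (⊛-⊙ (r hU) Fʲ (F k ⊛ F k)) (⊛-⊙ m₄ Fʲ (F k)))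
          (λ n → trans (+-comm _ _) (+-cong (*-congˡ (⊛-comm Fʲ (F k) n))
            (*-congˡ (≋-trans (⊛-comm Fʲ (F k ⊛ F k)) (⊛-assoc (F k) (F k) Fʲ) n)))))
      pointwise : (ιK (suc j) ⊙ (Fʲ ⊛ ((r hU ⊙ (F k ⊛ F k)) ⊕ (m₄ ⊙ F k))))
               ≋ (((ιK (suc j) * m₄) ⊙ (F k ^S suc j)) ⊕ ((ιK (suc j) * r hU) ⊙ (F k ^S suc (suc j))))
      pointwise n = trans (*-congˡ (reorder n)) (trans (distribˡ _ _ _) (+-cong (sym (*-assoc _ _ _)) (sym (*-assoc _ _ _))))

    module LeftSide = Tridiagonal (λ j → F k ^S suc j) (λ j → ιK (suc j) * m₄) (λ j → ιK (suc j) * r hU) Θ-F^S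

    left-coefficient : ℕ → ℕ → Carrier
    left-coefficient d j = (m₄ ^ (d ∸ j)) * (stirlingA d j * (r hU ^ j))

    left-coefficient-advance : ∀ d j → j ≤ suc d →
      left-coefficient (suc d) j ≈ LeftSide.advance (left-coefficient d) j
    left-coefficient-advance d zero    _ = begin
      m₄ * m₄ ^ d * (stirlingA (suc d) 0 * 1#)    ≈⟨ *-congˡ (*-congʳ (stirlingA-0 (suc d))) ⟩
      m₄ * m₄ ^ d * (1# * 1#)
        ≈⟨ solve 3 (λ m P o → m :* P :* (o :* o) := (con (+ 1) :* m) :* (P :* (o :* o))) refl m₄ (m₄ ^ d) 1# ⟩
      (ιK 1 * m₄) * (m₄ ^ d * (1# * 1#))          ≈⟨ *-congˡ (*-congˡ (*-congʳ (stirlingA-0 d))) ⟨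
      (ιK 1 * m₄) * (m₄ ^ d * (stirlingA d 0 * 1#)) ∎
    left-coefficient-advance d (suc t) t+1≤d+1 = begin
      P * (stirlingA (suc d) (suc t) * (r hU * R))                ≈⟨ *-congˡ (*-congʳ (stirlingA-suc d t)) ⟩
      P * ((i₂ * A₁ + i₁ * A₀) * (r hU * R))
        ≈⟨ solve 7 (λ P i₂ A₁ i₁ A₀ r R → P :* ((i₂ :* A₁ :+ i₁ :* A₀) :* (r :* R))
                                       := i₂ :* (P :* A₁) :* (r :* R) :+ (i₁ :* r) :* (P :* (A₀ :* R))) refl P i₂ A₁ i₁ A₀ (r hU) R ⟩
      i₂ * (P * A₁) * (r hU * R) + (i₁ * r hU) * (P * (A₀ * R))  ≈⟨ +-congʳ (*-congʳ (*-congˡ (^∸-stirlingA m₄ t+1≤d+1))) ⟩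
      i₂ * (m₄ * (P′ * A₁)) * (r hU * R) + (i₁ * r hU) * (P * (A₀ * R))
        ≈⟨ +-congʳ (solve 6 (λ i₂ m P′ A₁ r R → i₂ :* (m :* (P′ :* A₁)) :* (r :* R) := (i₂ :* m) :* (P′ :* (A₁ :* (r :* R))))
                           refl i₂ m₄ P′ A₁ (r hU) R) ⟩
      (i₂ * m₄) * (P′ * (A₁ * (r hU * R))) + (i₁ * r hU) * (P * (A₀ * R)) ∎
      where
      P = m₄ ^ (d ∸ t)
      P′ = m₄ ^ (d ∸ suc t)
      R = r hU ^ t
      i₁ = ιK (suc t)
      i₂ = ιK (suc (suc t))
      A₀ = stirlingA d t
      A₁ = stirlingA d (suc t)

    left-coefficient-vanish : ∀ d → left-coefficient d (suc d) ≈ 0#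
    left-coefficient-vanish d = trans (*-congˡ (*-congʳ (stirlingA-vanish (ℕ.n<1+n d))))
      (solve 2 (λ P R → P :* (con (+ 0) :* R) := con (+ 0)) refl (m₄ ^ (d ∸ suc d)) (r hU ^ suc d))

    LHS≋Θ^F : ∀ d → LHS k d hU ≋ Θ^ d (F k)
    LHS≋Θ^F d = ≋-trans
      (LeftSide.combination-orbit left-coefficient left-coefficient-advance left-coefficient-vanish d)
      (Θ^-cong d initial)
      where
      initial : LeftSide.combination 0 (left-coefficient 0) ≋ F k
      initial n = trans (*-cong (trans (*-identityˡ _) (trans (*-congʳ (stirlingA-0 0)) (*-identityˡ _))) (⊛-oneS (F k) n))
        (*-identityˡ _)

    Θ-g^S : ∀ j → Θ ((g ^S suc j) ⊛ derivN (suc j) (F k))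
      ≋ (((ιK (suc j) * - Q₂) ⊙ ((g ^S suc j) ⊛ derivN (suc j) (F k))) ⊕ (1# ⊙ ((g ^S suc (suc j)) ⊛ derivN (suc (suc j)) (F k))))
    Θ-g^S j = ≋-trans (Θ-h^S deriv-g j (derivN (suc j) (F k))) (⊕-cong ≋-refl (λ n → sym (*-identityˡ _)))

    module RightSide = Tridiagonal (λ j → (g ^S suc j) ⊛ derivN (suc j) (F k)) (λ j → ιK (suc j) * - Q₂) (λ _ → 1#) Θ-g^S

    right-coefficient : ℕ → ℕ → Carrier
    right-coefficient e j = sgn e * (Q₂ ^ (e ∸ j) * (invFact j * (sgn j * stirlingA e j)))

    RHS≋combination : ∀ e → RHS k (suc e) ≋ RightSide.combination e (right-coefficient e)
    RHS≋combination e n = trans (sumTo-suc e _) (trans (+-identityˡ _)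
      (sumTo-cong e (λ j _ → *-congʳ (*-congˡ (*-congˡ (*-congˡ (stirlingA-reverse e j)))))))

    right-coefficient-advance : ∀ e j → j ≤ suc e →
      right-coefficient (suc e) j ≈ RightSide.advance (right-coefficient e) j
    right-coefficient-advance e zero    _ = begin
      sgn (suc e) * (Q₂ * Q₂ ^ e * (invFact 0 * (1# * stirlingA (suc e) 0)))
        ≈⟨ *-cong (sgn-suc e) (*-congˡ (*-congˡ (*-congˡ (stirlingA-0 (suc e))))) ⟩
      - sgn e * (Q₂ * Q₂ ^ e * (invFact 0 * (1# * 1#)))
        ≈⟨ solve 4 (λ s Q P I → :- s :* (Q :* P :* I) := (con (+ 1) :* :- Q) :* (s :* (P :* I))) refl (sgn e) Q₂ (Q₂ ^ e) _ ⟩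
      (ιK 1 * - Q₂) * (sgn e * (Q₂ ^ e * (invFact 0 * (1# * 1#))))
        ≈⟨ *-congˡ (*-congˡ (*-congˡ (*-congˡ (*-congˡ (stirlingA-0 e))))) ⟨
      (ιK 1 * - Q₂) * (sgn e * (Q₂ ^ e * (invFact 0 * (1# * stirlingA e 0)))) ∎
    right-coefficient-advance e (suc t) t+1≤e+1 = trans left≈N (sym right≈N)
      where
      sₑ = sgn e
      sₜ = sgn t
      P = Q₂ ^ (e ∸ t)
      P′ = Q₂ ^ (e ∸ suc t)
      I₀ = invFact t
      I₁ = invFact (suc t)
      i₁ = ιK (suc t)
      i₂ = ιK (suc (suc t))
      A₀ = stirlingA e t
      A₁ = stirlingA e (suc t)
      N = i₂ * (sₑ * sₜ * I₁) * (Q₂ * (P′ * A₁)) + sₑ * (P * (I₀ * (sₜ * A₀)))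
      left≈N : right-coefficient (suc e) (suc t) ≈ N
      left≈N = begin
        sgn (suc e) * (P * (I₁ * (sgn (suc t) * stirlingA (suc e) (suc t))))
          ≈⟨ *-cong (sgn-suc e) (*-congˡ (*-congˡ (*-cong (sgn-suc t) (stirlingA-suc e t)))) ⟩
        - sₑ * (P * (I₁ * (- sₜ * (i₂ * A₁ + i₁ * A₀))))
          ≈⟨ solve 8 (λ sₑ sₜ P I₁ i₂ i₁ A₁ A₀ → :- sₑ :* (P :* (I₁ :* (:- sₜ :* (i₂ :* A₁ :+ i₁ :* A₀))))
                   := i₂ :* (sₑ :* sₜ :* I₁) :* (P :* A₁) :+ sₑ :* (P :* ((i₁ :* I₁) :* (sₜ :* A₀)))) refl sₑ sₜ P I₁ i₂ i₁ A₁ A₀ ⟩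
        i₂ * (sₑ * sₜ * I₁) * (P * A₁) + sₑ * (P * ((i₁ * I₁) * (sₜ * A₀)))
          ≈⟨ +-cong (*-congˡ (sym (^∸-stirlingA Q₂ t+1≤e+1))) (*-congˡ (*-congˡ (*-congʳ (invFact-suc t)))) ⟨
        N ∎
      right≈N : RightSide.advance (right-coefficient e) (suc t) ≈ N
      right≈N = begin
        (i₂ * - Q₂) * (sₑ * (P′ * (I₁ * (sgn (suc t) * A₁)))) + 1# * (sₑ * (P * (I₀ * (sₜ * A₀))))
          ≈⟨ +-cong (*-congˡ (*-congˡ (*-congˡ (*-congˡ (*-congʳ (sgn-suc t)))))) (*-identityˡ _) ⟩
        (i₂ * - Q₂) * (sₑ * (P′ * (I₁ * (- sₜ * A₁)))) + sₑ * (P * (I₀ * (sₜ * A₀)))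
          ≈⟨ +-congʳ (solve 7 (λ i₂ Q sₑ P′ I₁ sₜ A₁ → (i₂ :* :- Q) :* (sₑ :* (P′ :* (I₁ :* (:- sₜ :* A₁))))
                                                     := i₂ :* (sₑ :* sₜ :* I₁) :* (Q :* (P′ :* A₁)))
                   refl i₂ Q₂ sₑ P′ I₁ sₜ A₁) ⟩
        N ∎

    right-coefficient-vanish : ∀ e → right-coefficient e (suc e) ≈ 0#
    right-coefficient-vanish e = trans (*-congˡ (*-congˡ (*-congˡ (*-congˡ (stirlingA-vanish (ℕ.n<1+n e))))))
      (solve 4 (λ s P I S → s :* (P :* (I :* (S :* con (+ 0)))) := con (+ 0)) refl
        (sgn e) (Q₂ ^ (e ∸ suc e)) (invFact (suc e)) (sgn (suc e)))

    RHS≋Θ^ΘF : ∀ e → RHS k (suc e) ≋ Θ^ e (Θ (F k))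
    RHS≋Θ^ΘF e = ≋-trans (RHS≋combination e) (≋-trans
      (RightSide.combination-orbit right-coefficient right-coefficient-advance right-coefficient-vanish e)
      (Θ^-cong e initial))
      where
      initial : RightSide.combination 0 (right-coefficient 0) ≋ Θ (F k)
      initial n = trans (*-cong unit (⊛-congʳ (deriv (F k)) (⊛-oneS g) n)) (*-identityˡ _)
        where
        unit : right-coefficient 0 0 ≈ 1#
        unit = trans (*-identityˡ _) (trans (*-identityˡ _)
          (trans (*-cong invFact-0 (trans (*-identityˡ _) (stirlingA-0 0))) (*-identityˡ 1#)))

mainTheorem3 : {c ℓ : Level} (K : CharZeroField c ℓ) → let open Theory K in
    (α β : Carrier) (α≉β : ¬ (α - β ≈ 0#)) → let open Lucas α β α≉β in
    (k : ℕ) → 1 ≤ k → (hU : ¬ (U k ≈ 0#)) →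
    (d : ℕ) → 1 ≤ d →
    LHS k d hU ≋ RHS k d
mainTheorem3 K α β α≉β k _ hU (suc e) _ =
  ≋-trans (LHS≋Θ^F (suc e)) (≋-trans (Θ^-suc e (F k)) (≋-sym (RHS≋Θ^ΘF e)))
  where
  open Theory K
  open Lucas α β α≉β
  open PowerSeries K
  open LucasGeneratingFunction K α β α≉β k
  open BothSidesAsOrbits K α β α≉β k hU
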